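{- Let $h\in\mathbb{Z}_{\ge0}$ and $n\in\mathbb{N}$. (i) There is no integer $t$ with $1\le t\le \min(b_n+h,a_n)$ such that $(b_n+h-t,\,a_n-t)\in P_5$. (ii) There is no integer $t$ with $1\le t\le\min(a_n,b_n+h)$ such that $(a_n-t,\,b_n+h-t)\in P_5$. (That is, from $(b_n+h,a_n)$ or from $(a_n,b_n+h)$ no diagonal move reaches a position of $P_5$.)
   Context: Let $\sigma$ be the substitution on finite lists over $\{1,2\}$ acting letterwise by $\sigma(1)=2$, $\sigma(2)=2,1$. Let $C_1=(1,1,1,1,1)$ and $C_{i+1}=\sigma(C_i)$. Let $(c_n)_{n\in\mathbb{N}}$ be the infinite sequence obtained by concatenating $C_1, C_2, C_3, \dots$ in this order, and let $d_n=c_n+1$. Define $a_n = 6+\sum_{i=1}^{n-1} c_i$ and $b_n=12+\sum_{i=1}^{n-1} d_i$ for $n\in\mathbb{N}$. Let $P_{5,0}=\{(x,y)\in\mathbb{Z}_{\ge0}^2: x+y\le5\}$, $P_{5,1}=\{(b_n,a_n):n\in\mathbb{N}\}$, $P_{5,2}=\{(a_n,b_n):n\in\mathbb{N}\}$, and $P_5=P_{5,0}\cup P_{5,1}\cup P_{5,2}$. -}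

module Defs where

open import Data.Nat using (ℕ; zero; suc; _+_; _∸_; _≤_; _⊓_)
open import Data.List using (List; []; _∷_; _++_; concatMap; replicate; lookup; length)
open import Data.Product using (_×_; _,_; ∃-syntax)
open import Data.Sum using (_⊎_)
open import Relation.Binary.PropositionalEquality using (_≡_)

-- The alphabet {1,2} is represented by the natural numbers 1 and 2.
-- Substitution σ(1) = 2, σ(2) = 2,1 (applied letterwise; other letters unused).
σ₁ : ℕ → List ℕ
σ₁ 1 = 2 ∷ []
σ₁ _ = 2 ∷ 1 ∷ []

σ : List ℕ → List ℕ
σ = concatMap σ₁

-- C i for i ≥ 1 : C 1 = (1,1,1,1,1), C (i+1) = σ (C i).  (C 0 is unused, set = C 1.)
C : ℕ → List ℕ
C zero = replicate 5 1
C (suc zero) = replicate 5 1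
C (suc (suc i)) = σ (C (suc i))

blocks : ℕ → List ℕ
blocks zero = []
blocks (suc k) = blocks k ++ C (suc k)

nth : List ℕ → ℕ → ℕ
nth [] _ = 0
nth (x ∷ xs) zero = x
nth (x ∷ xs) (suc k) = nth xs k

-- c n for n ≥ 1 (1-based); blocks n has length ≥ 5n ≥ n, so the lookup is in range.
c : ℕ → ℕ
c n = nth (blocks n) (n ∸ 1)

d : ℕ → ℕ
d n = suc (c n)

sumBelow : (ℕ → ℕ) → ℕ → ℕ
sumBelow f zero = 0
sumBelow f (suc zero) = 0
sumBelow f (suc (suc m)) = sumBelow f (suc m) + f (suc m)

a : ℕ → ℕ
a n = 6 + sumBelow c n

b : ℕ → ℕ
b n = 12 + sumBelow d n

P5₀ : ℕ → ℕ → Set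
P5₀ x y = x + y ≤ 5

P5₁ : ℕ → ℕ → Set
P5₁ x y = ∃[ m ] (1 ≤ m × x ≡ b m × y ≡ a m)

P5₂ : ℕ → ℕ → Set
P5₂ x y = ∃[ m ] (1 ≤ m × x ≡ a m × y ≡ b m)

P5 : ℕ → ℕ → Set
P5 x y = P5₀ x y ⊎ (P5₁ x y ⊎ P5₂ x y)

{-# OPTIONS --safe #-}
-- Since d = c + 1, the gap b n − a n equals n + 5.  So every point of P₅ with
-- |x − y| ≥ 6 is (b m, a m) or (a m, b m), determined by its gap m + 5.  A
-- diagonal move from (b n + h, a n) keeps the gap n + h + 5 ≥ 6, so it could
-- only reach (b (n + h), a (n + h)); but the move strictly lowers the second
-- coordinate below a n ≤ a (n + h).  The other orientation follows by symmetry
-- of P₅.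
module Submission where

open import Defs
open import Data.Nat using (ℕ; zero; suc; _+_; _∸_; _≤_; _⊓_; _≤′_; ≤′-refl; ≤′-step; s≤s; z≤n)
open import Data.Nat.Properties
open import Data.Nat.Tactic.RingSolver using (solve-∀)
open import Data.Product using (_×_; _,_; ∃-syntax)
open import Data.Sum using (inj₁; inj₂)
open import Function using (_∘_)
open import Relation.Nullary using (¬_; contradiction)
open import Relation.Binary.PropositionalEquality using (_≡_; refl; sym; trans; cong; subst; module ≡-Reasoning)

sumBelow-suc : ∀ f m → sumBelow (λ i → suc (f i)) (suc m) ≡ sumBelow f (suc m) + m
sumBelow-suc f zero    = refl
sumBelow-suc f (suc m) = begin
  sumBelow (λ i → suc (f i)) (suc m) + suc (f (suc m)) ≡⟨ cong (_+ suc (f (suc m))) (sumBelow-suc f m) ⟩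
  sumBelow f (suc m) + m + suc (f (suc m))             ≡⟨ reorder (sumBelow f (suc m)) m (f (suc m)) ⟩
  sumBelow f (suc m) + f (suc m) + suc m               ∎
  where
  open ≡-Reasoning
  reorder : ∀ s m x → s + m + suc x ≡ s + x + suc m
  reorder = solve-∀

sumBelow-mono-≤ : ∀ f {m n} → m ≤ n → sumBelow f m ≤ sumBelow f n
sumBelow-mono-≤ f = mono′ ∘ ≤⇒≤′
  where
  step : ∀ n → sumBelow f n ≤ sumBelow f (suc n)
  step zero    = z≤n
  step (suc n) = m≤m+n _ _

  mono′ : ∀ {m n} → m ≤′ n → sumBelow f m ≤ sumBelow f n
  mono′ ≤′-refl           = ≤-refl
  mono′ (≤′-step {n} m≤n) = ≤-trans (mono′ m≤n) (step n)

a-mono-≤ : ∀ {m n} → m ≤ n → a m ≤ a n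
a-mono-≤ = +-monoʳ-≤ 6 ∘ sumBelow-mono-≤ c

b+h≡a+[n+h+5] : ∀ {n} h → 1 ≤ n → b n + h ≡ a n + (n + h + 5)
b+h≡a+[n+h+5] {suc n} h _ = begin
  12 + sumBelow d (suc n) + h              ≡⟨ cong (λ s → 12 + s + h) (sumBelow-suc c n) ⟩
  12 + (sumBelow c (suc n) + n) + h        ≡⟨ reorder (sumBelow c (suc n)) n h ⟩
  6 + sumBelow c (suc n) + (suc n + h + 5) ∎
  where
  open ≡-Reasoning
  reorder : ∀ s n h → 12 + (s + n) + h ≡ 6 + s + (suc n + h + 5)
  reorder = solve-∀

b≡a+[n+5] : ∀ {n} → 1 ≤ n → b n ≡ a n + (n + 5)
b≡a+[n+5] {n} n≥1 = begin
  b n               ≡⟨ sym (+-identityʳ (b n)) ⟩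
  b n + 0           ≡⟨ b+h≡a+[n+h+5] 0 n≥1 ⟩
  a n + (n + 0 + 5) ≡⟨ cong (λ k → a n + (k + 5)) (+-identityʳ n) ⟩
  a n + (n + 5)     ∎
  where open ≡-Reasoning

P5-swap : ∀ {x y} → P5 x y → P5 y x
P5-swap {x} {y} (inj₁ x+y≤5)                   = inj₁ (subst (_≤ 5) (+-comm x y) x+y≤5)
P5-swap (inj₂ (inj₁ (m , m≥1 , x≡bm , y≡am))) = inj₂ (inj₂ (m , m≥1 , y≡am , x≡bm))
P5-swap (inj₂ (inj₂ (m , m≥1 , x≡am , y≡bm))) = inj₂ (inj₁ (m , m≥1 , y≡bm , x≡am))

P5-gap : ∀ {y k} → 6 ≤ k → P5 (y + k) y → ∃[ m ] (y ≡ a m × k ≡ m + 5)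
P5-gap {y} {k} k≥6 (inj₁ y+k+y≤5) =
  contradiction (≤-trans k≥6 (≤-trans (m≤n+m k y) (m≤m+n (y + k) y))) (<⇒≱ (s≤s y+k+y≤5))
P5-gap {y} {k} _ (inj₂ (inj₁ (m , m≥1 , y+k≡bm , y≡am))) =
  m , y≡am , +-cancelˡ-≡ (a m) k (m + 5) (begin
    a m + k       ≡⟨ cong (_+ k) (sym y≡am) ⟩
    y + k         ≡⟨ y+k≡bm ⟩
    b m           ≡⟨ b≡a+[n+5] m≥1 ⟩
    a m + (m + 5) ∎)
  where open ≡-Reasoning
P5-gap {y} {k} k≥6 (inj₂ (inj₂ (m , m≥1 , y+k≡am , y≡bm))) =
  contradiction (begin-strict
    a m           ≤⟨ m≤m+n (a m) (m + 5) ⟩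
    a m + (m + 5) ≡⟨ sym (b≡a+[n+5] m≥1) ⟩
    b m           ≡⟨ sym y≡bm ⟩
    y             <⟨ m<m+n y (≤-trans (s≤s z≤n) k≥6) ⟩
    y + k         ≡⟨ y+k≡am ⟩
    a m           ∎) (<-irrefl refl)
  where open ≤-Reasoning

no-diagonal-move : ∀ h {n} t → 1 ≤ n → 1 ≤ t → t ≤ a n → ¬ P5 (b n + h ∸ t) (a n ∸ t)
no-diagonal-move h {n} t n≥1 t≥1 t≤an = not-on-gap ∘ P5-gap gap≥6 ∘ subst (λ x → P5 x (a n ∸ t)) shifted
  where
  gap≥6 : 6 ≤ n + h + 5
  gap≥6 = +-monoˡ-≤ 5 (≤-trans n≥1 (m≤m+n n h))

  shifted : b n + h ∸ t ≡ (a n ∸ t) + (n + h + 5)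
  shifted = trans (cong (_∸ t) (b+h≡a+[n+h+5] h n≥1)) (+-∸-comm (n + h + 5) t≤an)

  not-on-gap : ¬ (∃[ m ] (a n ∸ t ≡ a m × n + h + 5 ≡ m + 5))
  not-on-gap (m , an∸t≡am , gap) with refl ← +-cancelʳ-≡ 5 (n + h) m gap =
    <-irrefl an∸t≡am (<-≤-trans (∸-monoʳ-< t≥1 t≤an) (a-mono-≤ (m≤m+n n h)))

lemma4p8 : (h n : ℕ) → 1 ≤ n →
    ((t : ℕ) → 1 ≤ t → t ≤ (b n + h) ⊓ a n → ¬ P5 (b n + h ∸ t) (a n ∸ t))
    × ((t : ℕ) → 1 ≤ t → t ≤ a n ⊓ (b n + h) → ¬ P5 (a n ∸ t) (b n + h ∸ t))
lemma4p8 h n n≥1 =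
  (λ t t≥1 t≤ → no-diagonal-move h t n≥1 t≥1 (≤-trans t≤ (m⊓n≤n (b n + h) (a n)))) ,
  (λ t t≥1 t≤ → no-diagonal-move h t n≥1 t≥1 (≤-trans t≤ (m⊓n≤m (a n) (b n + h))) ∘ P5-swap)
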